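{- If $G$ is a Left dead end with a good option equal to $\overline{n}$ for some integer $n\geq0$, then either $G=\overline{n+1}$, or $G$ is an atom.
   Context: All games are short partizan combinatorial game forms; $G+H$ is the disjunctive sum. Play is misère (a player unable to move wins). Misère outcome classes are ordered $\mathscr L>\mathscr P>\mathscr R$ and $\mathscr L>\mathscr N>\mathscr R$; $G\geq H$ means that for every game $X$ the misère outcome of $G+X$ is $\geq$ that of $H+X$, $G=H$ means $G\ge H$ and $H\ge G$, and $G>H$ means $G\ge H$ and $G\ne H$. A Left dead end is a game no subposition of which (including itself) has a Left option; its options are its Right options. An option $G'$ of $G$ is good if there is no option $G''$ of $G$ with $G'>G''$. Let $0=\{\cdot\mid\cdot\}$, $\overline0=0$ and $\overline{n}=\{\cdot\mid\overline{n-1}\}$ for $n\geq1$. An atom is a Left dead end $A\neq0$ such that $A=X+Y$ with Left dead ends $X,Y$ implies $X=0$ or $Y=0$. -}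

module Defs where

open import Data.Nat using (ℕ; zero; suc; _+_)
open import Data.Fin using (Fin; splitAt)
open import Data.Bool using (Bool; true; false; not; _∨_)
open import Data.Sum using (_⊎_; inj₁; inj₂; [_,_])
open import Data.Product using (_×_; Σ)
open import Relation.Nullary using (¬_)

data Game : Set where
  mk : (nL : ℕ) → (Fin nL → Game) → (nR : ℕ) → (Fin nR → Game) → Game

zeroG : Game
zeroG = mk 0 (λ ()) 0 (λ ())

nbar : ℕ → Game
nbar zero = zeroG
nbar (suc n) = mk 0 (λ ()) 1 (λ _ → nbar n)

infixl 6 _⊕_
_⊕_ : Game → Game → Game
mk nL gL nR gR ⊕ mk mL hL mR hR =
  mk (nL + mL)
     (λ i → [ (λ a → gL a ⊕ mk mL hL mR hR) , (λ b → mk nL gL nR gR ⊕ hL b) ] (splitAt nL i))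
     (nR + mR)
     (λ i → [ (λ a → gR a ⊕ mk mL hL mR hR) , (λ b → mk nL gL nR gR ⊕ hR b) ] (splitAt nR i))

anyFin : (n : ℕ) → (Fin n → Bool) → Bool
anyFin zero f = false
anyFin (suc n) f = f Fin.zero ∨ anyFin n (λ i → f (Fin.suc i))

-- Misère play: a player unable to move wins.
mutual
  leftWinsFirst : Game → Bool
  leftWinsFirst (mk zero gL nR gR) = true
  leftWinsFirst (mk (suc n) gL nR gR) = anyFin (suc n) (λ i → not (rightWinsFirst (gL i)))

  rightWinsFirst : Game → Bool
  rightWinsFirst (mk nL gL zero gR) = true
  rightWinsFirst (mk nL gL (suc n) gR) = anyFin (suc n) (λ j → not (leftWinsFirst (gR j)))

data Outcome : Set where
  𝓛 𝓝 𝓟 𝓡 : Outcome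

outcome : Game → Outcome
outcome G with leftWinsFirst G | rightWinsFirst G
... | true  | false = 𝓛
... | true  | true  = 𝓝
... | false | false = 𝓟
... | false | true  = 𝓡

data _≤o_ : Outcome → Outcome → Set where
  ≤o-refl : ∀ {o} → o ≤o o
  𝓡≤ : ∀ {o} → 𝓡 ≤o o
  ≤𝓛 : ∀ {o} → o ≤o 𝓛

_≥g_ : Game → Game → Set
G ≥g H = (X : Game) → outcome (H ⊕ X) ≤o outcome (G ⊕ X)

_≡g_ : Game → Game → Set
G ≡g H = (G ≥g H) × (H ≥g G)

_>g_ : Game → Game → Set
G >g H = (G ≥g H) × ¬ (G ≡g H)

data LeftDeadEnd : Game → Set where
  lde : ∀ {gL : Fin 0 → Game} {nR} {gR : Fin nR → Game} →
        (∀ j → LeftDeadEnd (gR j)) → LeftDeadEnd (mk 0 gL nR gR)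

numOpts : Game → ℕ
numOpts (mk nL gL nR gR) = nL + nR

option : (G : Game) → Fin (numOpts G) → Game
option (mk nL gL nR gR) i = [ gL , gR ] (splitAt nL i)

GoodOption : (G : Game) → Fin (numOpts G) → Set
GoodOption G i = (k : Fin (numOpts G)) → ¬ (option G i >g option G k)

Atom : Game → Set
Atom A = LeftDeadEnd A × ¬ (A ≡g zeroG) ×
  ((X Y : Game) → LeftDeadEnd X → LeftDeadEnd Y → A ≡g (X ⊕ Y) →
     (X ≡g zeroG) ⊎ (Y ≡g zeroG))

-- For Left dead ends, G ≥ H holds exactly when H has no Right option whenever G has none, and
-- every Right option of G dominates some Right option of H.  Measured against n̄ this says that
-- G ≥ n̄ iff every Right run of G has length n, and n̄ ≥ G iff some Right run of G has length n,
-- where a Right run is a sequence of Right moves ending where Right cannot move.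
--
-- Let the good option G' of G equal n̄.  If G = X + Y with X, Y ≠ 0, then G ≥ X + Y makes n̄
-- dominate a Right option T of X + Y, so T has a run of length n.  Conversely X + Y ≥ G makes
-- every Right option T of X + Y dominate some option G'' of G; if T has a run of length n then
-- G' ≥ G'', goodness forces G' = G'', and so every run of T has length n.  Run lengths add up
-- along disjunctive sums, and the rigidity of these options of X + Y forces all runs of X and of
-- Y to have constant lengths summing to n + 1.  Hence G ≥ n̄+1, and n̄+1 ≥ G because of the
-- option n̄: either G = n̄+1, or G has no nontrivial decomposition and is an atom.
module Submission where

open import Defs
open import Data.Nat using (ℕ; suc)
open import Data.Fin using (Fin)
open import Data.Sum using (_⊎_)
open import Data.Product using (Σ; _×_)

open import Data.Bool using (Bool; true; false; not; T)
open import Data.Bool.Properties using (T-∨)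
open import Data.Empty using (⊥-elim)
open import Data.Fin using (zero; suc; splitAt; _↑ˡ_; _↑ʳ_)
open import Data.Fin.Properties using (splitAt-↑ˡ; splitAt-↑ʳ; ¬Fin0; all?)
open import Data.Nat using (zero; _+_; _≟_)
open import Data.Nat.Properties
  using (m+n≡0⇒m≡0; m+n≡0⇒n≡0; +-identityʳ; +-suc; +-comm; +-cancelˡ-≡; +-cancelʳ-≡; 1+n≢0;
         suc-injective)
open import Data.Product using (_,_; proj₁; proj₂; ∃; ∃₂)
import Data.Product as Product
open import Data.Sum using (inj₁; inj₂; [_,_]; [_,_]′)
import Data.Sum as Sum
open import Data.Unit using (tt)
open import Function using (_∘_; id; flip)
open import Function.Bundles using (_⇔_; mk⇔; Equivalence)
open import Relation.Binary.Bundles using (Preorder)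
open import Relation.Binary.PropositionalEquality
  using (_≡_; refl; sym; trans; cong; cong₂; subst; isEquivalence)
import Relation.Binary.Reasoning.Preorder
open import Relation.Nullary using (¬_; contraposition; Dec; yes; no)
open import Relation.Nullary.Decidable using (decidable-stable)
import Relation.Nullary.Decidable as Dec

open Equivalence using (to; from)

Ln Rn : Game → ℕ
Ln (mk nL _ _ _) = nL
Rn (mk _ _ nR _) = nR

Lo : (G : Game) → Fin (Ln G) → Game
Lo (mk _ gL _ _) = gL

Ro : (G : Game) → Fin (Rn G) → Game
Ro (mk _ _ _ gR) = gR

T-not : ∀ {b} → T (not b) ⇔ (¬ T b)
T-not {false} = mk⇔ (λ _ ()) (λ _ → tt)
T-not {true} = mk⇔ (λ ()) (λ ¬t → ¬t tt)

T-anyFin : ∀ n (f : Fin n → Bool) → T (anyFin n f) ⇔ ∃ λ i → T (f i)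
T-anyFin zero f = mk⇔ (λ ()) (λ ())
T-anyFin (suc n) f = mk⇔
  ([ (zero ,_) , Product.map suc id ∘ to (T-anyFin n (f ∘ suc)) ] ∘ to T-∨)
  (λ { (zero , t) → from T-∨ (inj₁ t)
     ; (suc i , t) → from T-∨ (inj₂ (from (T-anyFin n (f ∘ suc)) (i , t))) })

leftWinsFirst⇔ : ∀ G → T (leftWinsFirst G) ⇔ (Ln G ≡ 0 ⊎ ∃ λ i → ¬ T (rightWinsFirst (Lo G i)))
leftWinsFirst⇔ (mk zero _ _ _) = mk⇔ (λ _ → inj₁ refl) (λ _ → tt)
leftWinsFirst⇔ (mk (suc _) _ _ _) = mk⇔
  (inj₂ ∘ Product.map₂ (to T-not) ∘ to (T-anyFin _ _))
  [ (λ ()) , from (T-anyFin _ _) ∘ Product.map₂ (from T-not) ]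

rightWinsFirst⇔ : ∀ G → T (rightWinsFirst G) ⇔ (Rn G ≡ 0 ⊎ ∃ λ k → ¬ T (leftWinsFirst (Ro G k)))
rightWinsFirst⇔ (mk _ _ zero _) = mk⇔ (λ _ → inj₁ refl) (λ _ → tt)
rightWinsFirst⇔ (mk _ _ (suc _) _) = mk⇔
  (inj₂ ∘ Product.map₂ (to T-not) ∘ to (T-anyFin _ _))
  [ (λ ()) , from (T-anyFin _ _) ∘ Product.map₂ (from T-not) ]

rightLosesFirst : ∀ G → Fin (Rn G) → (∀ k → T (leftWinsFirst (Ro G k))) → ¬ T (rightWinsFirst G)
rightLosesFirst G@(mk _ _ (suc _) _) _ h w =
  [ (λ ()) , (λ (k , l) → l (h k)) ]′ (to (rightWinsFirst⇔ G) w)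

leftWinsO rightWinsO : Outcome → Bool
leftWinsO 𝓛 = true
leftWinsO 𝓝 = true
leftWinsO 𝓟 = false
leftWinsO 𝓡 = false
rightWinsO 𝓛 = false
rightWinsO 𝓝 = true
rightWinsO 𝓟 = false
rightWinsO 𝓡 = true

leftWinsO-outcome : ∀ G → leftWinsO (outcome G) ≡ leftWinsFirst G
leftWinsO-outcome G with leftWinsFirst G | rightWinsFirst G
... | true  | false = refl
... | true  | true  = refl
... | false | false = refl
... | false | true  = refl

rightWinsO-outcome : ∀ G → rightWinsO (outcome G) ≡ rightWinsFirst G
rightWinsO-outcome G with leftWinsFirst G | rightWinsFirst G
... | true  | false = refl
... | true  | true  = refl
... | false | false = refl
... | false | true  = refl

≤o-trans : ∀ {o o′ o″} → o ≤o o′ → o′ ≤o o″ → o ≤o o″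
≤o-trans p ≤o-refl = p
≤o-trans _ ≤𝓛 = ≤𝓛
≤o-trans ≤o-refl q = q
≤o-trans 𝓡≤ _ = 𝓡≤

≤o⇔ : ∀ {o o′} → o ≤o o′ ⇔
  ((T (leftWinsO o) → T (leftWinsO o′)) × (T (rightWinsO o′) → T (rightWinsO o)))
≤o⇔ = mk⇔ ≤o⇒wins wins⇒≤o
  where
  ≤o⇒wins : ∀ {o o′} → o ≤o o′ →
    (T (leftWinsO o) → T (leftWinsO o′)) × (T (rightWinsO o′) → T (rightWinsO o))
  ≤o⇒wins ≤o-refl = id , id
  ≤o⇒wins 𝓡≤ = (λ ()) , (λ _ → tt)
  ≤o⇒wins ≤𝓛 = (λ _ → tt) , (λ ())
  wins⇒≤o : ∀ {o o′} →
    (T (leftWinsO o) → T (leftWinsO o′)) × (T (rightWinsO o′) → T (rightWinsO o)) → o ≤o o′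
  wins⇒≤o {𝓡} _ = 𝓡≤
  wins⇒≤o {_} {𝓛} _ = ≤𝓛
  wins⇒≤o {𝓝} {𝓝} _ = ≤o-refl
  wins⇒≤o {𝓟} {𝓟} _ = ≤o-refl
  wins⇒≤o {𝓛} {𝓝} (_ , r) = ⊥-elim (r tt)
  wins⇒≤o {𝓛} {𝓟} (l , _) = ⊥-elim (l tt)
  wins⇒≤o {𝓛} {𝓡} (l , _) = ⊥-elim (l tt)
  wins⇒≤o {𝓝} {𝓟} (l , _) = ⊥-elim (l tt)
  wins⇒≤o {𝓝} {𝓡} (l , _) = ⊥-elim (l tt)
  wins⇒≤o {𝓟} {𝓝} (_ , r) = ⊥-elim (r tt)
  wins⇒≤o {𝓟} {𝓡} (_ , r) = ⊥-elim (r tt)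

-- outcome is defined by with-abstraction, so it has to be abstracted before rewriting.
outcome-≤o⇔ : ∀ A B → outcome A ≤o outcome B ⇔
  ((T (leftWinsFirst A) → T (leftWinsFirst B)) × (T (rightWinsFirst B) → T (rightWinsFirst A)))
outcome-≤o⇔ A B
  with outcome A | leftWinsO-outcome A | rightWinsO-outcome A
     | outcome B | leftWinsO-outcome B | rightWinsO-outcome B
... | _ | lA | rA | _ | lB | rB rewrite sym lA | sym rA | sym lB | sym rB = ≤o⇔

≥g-intro : ∀ {G H} → (∀ X → (T (leftWinsFirst (H ⊕ X)) → T (leftWinsFirst (G ⊕ X))) ×
                            (T (rightWinsFirst (G ⊕ X)) → T (rightWinsFirst (H ⊕ X)))) → G ≥g H
≥g-intro {G} {H} h X = from (outcome-≤o⇔ (H ⊕ X) (G ⊕ X)) (h X)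

≥g-rightWinsFirst : ∀ {G H} → G ≥g H → ∀ X → T (rightWinsFirst (G ⊕ X)) → T (rightWinsFirst (H ⊕ X))
≥g-rightWinsFirst {G} {H} G≥H X = proj₂ (to (outcome-≤o⇔ (H ⊕ X) (G ⊕ X)) (G≥H X))

≥g-preorder : Preorder _ _ _
≥g-preorder = record
  { Carrier = Game
  ; _≈_ = _≡_
  ; _≲_ = flip _≥g_
  ; isPreorder = record
    { isEquivalence = isEquivalence
    ; reflexive = λ { refl _ → ≤o-refl }
    ; trans = λ H≥G K≥H X → ≤o-trans (H≥G X) (K≥H X)
    }
  }

module ≥g-Reasoning = Relation.Binary.Reasoning.Preorder ≥g-preorder

data RightOption (G : Game) : Game → Set where
  at : ∀ k → RightOption G (Ro G k)

∃Ro : ∀ {G K} (P : Game → Set) → RightOption G K → P K → ∃ λ k → P (Ro G k)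
∃Ro P (at k) p = k , p

∀Ro : ∀ {G K} {P : Game → Set} → (∀ k → P (Ro G k)) → RightOption G K → P K
∀Ro h (at k) = h k

Rn-⊕ : ∀ A B → Rn (A ⊕ B) ≡ Rn A + Rn B
Rn-⊕ (mk _ _ _ _) (mk _ _ _ _) = refl

Ro-⊕ˡ : ∀ A B a → RightOption (A ⊕ B) (Ro A a ⊕ B)
Ro-⊕ˡ A@(mk _ _ nA _) B@(mk _ _ nB _) a =
  subst (RightOption (A ⊕ B)) (cong [ _ , _ ] (splitAt-↑ˡ nA a nB)) (at (a ↑ˡ nB))

Ro-⊕ʳ : ∀ A B b → RightOption (A ⊕ B) (A ⊕ Ro B b)
Ro-⊕ʳ A@(mk _ _ nA _) B@(mk _ _ nB _) b =
  subst (RightOption (A ⊕ B)) (cong [ _ , _ ] (splitAt-↑ʳ nA nB b)) (at (nA ↑ʳ b))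

Ro-⊕-elim : ∀ {A B} (P : Game → Set) → (∀ a → P (Ro A a ⊕ B)) → (∀ b → P (A ⊕ Ro B b)) →
  ∀ k → P (Ro (A ⊕ B) k)
Ro-⊕-elim {mk _ _ nA _} {mk _ _ _ _} P pˡ pʳ k with splitAt nA k
... | inj₁ a = pˡ a
... | inj₂ b = pʳ b

rightWinsFirst-move : ∀ {G K} → RightOption G K → ¬ T (leftWinsFirst K) → T (rightWinsFirst G)
rightWinsFirst-move {G} o l = from (rightWinsFirst⇔ G) (inj₂ (∃Ro (λ K → ¬ T (leftWinsFirst K)) o l))

LeftDeadEnd-⊕ : ∀ {A B} → LeftDeadEnd A → LeftDeadEnd B → LeftDeadEnd (A ⊕ B)
LeftDeadEnd-⊕ {A} {B} dA@(lde dAʳ) dB@(lde dBʳ) =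
  lde (Ro-⊕-elim {A} {B} LeftDeadEnd (λ a → LeftDeadEnd-⊕ (dAʳ a) dB) (λ b → LeftDeadEnd-⊕ dA (dBʳ b)))

LeftDeadEnd-Ro : ∀ {G} → LeftDeadEnd G → ∀ k → LeftDeadEnd (Ro G k)
LeftDeadEnd-Ro (lde dʳ) = dʳ

LeftDeadEnd-nbar : ∀ n → LeftDeadEnd (nbar n)
LeftDeadEnd-nbar zero = lde (λ ())
LeftDeadEnd-nbar (suc n) = lde (λ _ → LeftDeadEnd-nbar n)

leftWinsFirst-deadEnd : ∀ {D} → LeftDeadEnd D → T (leftWinsFirst D)
leftWinsFirst-deadEnd (lde _) = tt

rightLosesFirst-deadEnd : ∀ {D} → LeftDeadEnd D → Fin (Rn D) → ¬ T (rightWinsFirst D)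
rightLosesFirst-deadEnd {D} dD k = rightLosesFirst D k (leftWinsFirst-deadEnd ∘ LeftDeadEnd-Ro dD)

leftWinsFirst-⊕⇔ : ∀ {D} X → LeftDeadEnd D →
  T (leftWinsFirst (D ⊕ X)) ⇔ (Ln X ≡ 0 ⊎ ∃ λ i → ¬ T (rightWinsFirst (D ⊕ Lo X i)))
leftWinsFirst-⊕⇔ {D} X@(mk _ _ _ _) (lde _) = leftWinsFirst⇔ (D ⊕ X)

leftWinsFirst-⊕ : ∀ {D X} → LeftDeadEnd D → (i : Fin (Ln X)) →
  ¬ T (rightWinsFirst (D ⊕ Lo X i)) → T (leftWinsFirst (D ⊕ X))
leftWinsFirst-⊕ {X = X} dD i r = from (leftWinsFirst-⊕⇔ X dD) (inj₂ (i , r))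

leftLosesFirst-⊕ : ∀ {D X} → LeftDeadEnd D → Fin (Ln X) →
  (∀ i → T (rightWinsFirst (D ⊕ Lo X i))) → ¬ T (leftWinsFirst (D ⊕ X))
leftLosesFirst-⊕ {X = X@(mk (suc _) _ _ _)} dD _ h w =
  [ (λ ()) , (λ (i , r) → r (h i)) ]′ (to (leftWinsFirst-⊕⇔ X dD) w)

AllRuns SomeRun : Game → ℕ → Set
AllRuns G zero = Rn G ≡ 0
AllRuns G (suc n) = Fin (Rn G) × (∀ k → AllRuns (Ro G k) n)
SomeRun G zero = Rn G ≡ 0
SomeRun G (suc n) = ∃ λ k → SomeRun (Ro G k) n

someRun : ∀ G → ∃ (SomeRun G)
someRun (mk _ _ zero _) = 0 , refl
someRun (mk _ _ (suc _) gR) = let m , run = someRun (gR zero) in suc m , zero , run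

AllRuns⇒SomeRun : ∀ G n → AllRuns G n → SomeRun G n
AllRuns⇒SomeRun G zero noMove = noMove
AllRuns⇒SomeRun G (suc n) (k , all) = k , AllRuns⇒SomeRun (Ro G k) n (all k)

AllRuns-SomeRun-≡ : ∀ G n m → AllRuns G n → SomeRun G m → m ≡ n
AllRuns-SomeRun-≡ G zero zero _ _ = refl
AllRuns-SomeRun-≡ G zero (suc m) noMove (k , _) = ⊥-elim (¬Fin0 (subst Fin noMove k))
AllRuns-SomeRun-≡ G (suc n) zero (k , _) noMove = ⊥-elim (¬Fin0 (subst Fin noMove k))
AllRuns-SomeRun-≡ G (suc n) (suc m) (_ , all) (k , run) =
  cong suc (AllRuns-SomeRun-≡ (Ro G k) n m (all k) run)

SomeRun-≡⇒AllRuns : ∀ G n → (∀ m → SomeRun G m → m ≡ n) → AllRuns G n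
SomeRun-≡⇒AllRuns (mk _ _ zero _) zero _ = refl
SomeRun-≡⇒AllRuns (mk _ _ (suc _) gR) zero runs≡ =
  let m , run = someRun (gR zero) in ⊥-elim (1+n≢0 (runs≡ (suc m) (zero , run)))
SomeRun-≡⇒AllRuns (mk _ _ zero _) (suc n) runs≡ = ⊥-elim (1+n≢0 (sym (runs≡ 0 refl)))
SomeRun-≡⇒AllRuns (mk _ _ (suc _) gR) (suc n) runs≡ =
  zero , λ k → SomeRun-≡⇒AllRuns (gR k) n (λ m run → suc-injective (runs≡ (suc m) (k , run)))

AllRuns? : ∀ G n → Dec (AllRuns G n)
AllRuns? G zero = Rn G ≟ 0
AllRuns? (mk _ _ zero _) (suc n) = no (¬Fin0 ∘ proj₁)
AllRuns? (mk _ _ (suc _) gR) (suc n) = Dec.map′ (zero ,_) proj₂ (all? λ k → AllRuns? (gR k) n)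

SomeRun-⊕ : ∀ A B a b → SomeRun A a → SomeRun B b → SomeRun (A ⊕ B) (a + b)
SomeRun-⊕ A B zero zero noMoveA noMoveB = trans (Rn-⊕ A B) (cong₂ _+_ noMoveA noMoveB)
SomeRun-⊕ A B zero (suc b) noMoveA (j , run) =
  ∃Ro (λ K → SomeRun K b) (Ro-⊕ʳ A B j) (SomeRun-⊕ A (Ro B j) zero b noMoveA run)
SomeRun-⊕ A B (suc a) b (i , run) runB =
  ∃Ro (λ K → SomeRun K (a + b)) (Ro-⊕ˡ A B i) (SomeRun-⊕ (Ro A i) B a b run runB)

SomeRun-⊕⁻ : ∀ A B c → SomeRun (A ⊕ B) c → ∃₂ λ a b → SomeRun A a × SomeRun B b × a + b ≡ c
SomeRun-⊕⁻ A B zero noMove =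
  0 , 0 , m+n≡0⇒m≡0 (Rn A) noMove′ , m+n≡0⇒n≡0 (Rn A) noMove′ , refl
  where noMove′ = trans (sym (Rn-⊕ A B)) noMove
SomeRun-⊕⁻ A B (suc c) (k , run) =
  Ro-⊕-elim {A} {B} (λ K → SomeRun K c → ∃₂ λ a b → SomeRun A a × SomeRun B b × a + b ≡ suc c)
    (λ i run → let a , b , runA , runB , a+b≡c = SomeRun-⊕⁻ (Ro A i) B c run in
      suc a , b , (i , runA) , runB , cong suc a+b≡c)
    (λ j run → let a , b , runA , runB , a+b≡c = SomeRun-⊕⁻ A (Ro B j) c run in
      a , suc b , runA , (j , runB) , trans (+-suc a b) (cong suc a+b≡c))
    k run

AllRuns-⊕ : ∀ A B a b → AllRuns A a → AllRuns B b → AllRuns (A ⊕ B) (a + b)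
AllRuns-⊕ A B a b allA allB = SomeRun-≡⇒AllRuns (A ⊕ B) (a + b) λ m run →
  let a′ , b′ , runA , runB , a′+b′≡m = SomeRun-⊕⁻ A B m run in
  trans (sym a′+b′≡m)
        (cong₂ _+_ (AllRuns-SomeRun-≡ A a a′ allA runA) (AllRuns-SomeRun-≡ B b b′ allB runB))

AllRuns-⊕⁻ : ∀ A B c → AllRuns (A ⊕ B) c → ∃₂ λ a b → AllRuns A a × AllRuns B b × a + b ≡ c
AllRuns-⊕⁻ A B c all =
  a , b
  , SomeRun-≡⇒AllRuns A a (λ a′ runA′ →
      +-cancelʳ-≡ b a′ a (trans (≡c (SomeRun-⊕ A B a′ b runA′ runB)) (sym a+b≡c)))
  , SomeRun-≡⇒AllRuns B b (λ b′ runB′ →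
      +-cancelˡ-≡ a b′ b (trans (≡c (SomeRun-⊕ A B a b′ runA runB′)) (sym a+b≡c)))
  , a+b≡c
  where
  a = proj₁ (someRun A)
  runA = proj₂ (someRun A)
  b = proj₁ (someRun B)
  runB = proj₂ (someRun B)
  ≡c : ∀ {m} → SomeRun (A ⊕ B) m → m ≡ c
  ≡c = AllRuns-SomeRun-≡ (A ⊕ B) c _ all
  a+b≡c = ≡c (SomeRun-⊕ A B a b runA runB)

SomeRun-⊕-comm : ∀ A B c → SomeRun (A ⊕ B) c → SomeRun (B ⊕ A) c
SomeRun-⊕-comm A B c run with SomeRun-⊕⁻ A B c run
... | a , b , runA , runB , refl = subst (SomeRun (B ⊕ A)) (+-comm b a) (SomeRun-⊕ B A b a runB runA)

AllRuns-⊕-comm : ∀ A B c → AllRuns (A ⊕ B) c → AllRuns (B ⊕ A) c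
AllRuns-⊕-comm A B c all with AllRuns-⊕⁻ A B c all
... | a , b , allA , allB , refl = subst (AllRuns (B ⊕ A)) (+-comm b a) (AllRuns-⊕ B A b a allB allA)

infix 4 _≽_
_≽_ : Game → Game → Set
mk _ _ nR gR ≽ mk _ _ mR hR = (nR ≡ 0 → mR ≡ 0) × (∀ i → ∃ λ j → gR i ≽ hR j)

mutual
  ≽-leftWinsFirst : ∀ {G H} X → LeftDeadEnd G → LeftDeadEnd H → G ≽ H →
    T (leftWinsFirst (H ⊕ X)) → T (leftWinsFirst (G ⊕ X))
  ≽-leftWinsFirst {G} {H} X@(mk _ xL _ _) dG dH G≽H =
    from (leftWinsFirst-⊕⇔ {G} X dG)
    ∘ Sum.map₂ (Product.map₂ (λ {i} → contraposition (≽-rightWinsFirst (xL i) dG dH G≽H)))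
    ∘ to (leftWinsFirst-⊕⇔ {H} X dH)

  ≽-rightWinsFirst : ∀ {G H} X → LeftDeadEnd G → LeftDeadEnd H → G ≽ H →
    T (rightWinsFirst (G ⊕ X)) → T (rightWinsFirst (H ⊕ X))
  ≽-rightWinsFirst {G@(mk 0 _ nR _)} {H@(mk 0 _ mR _)} X@(mk _ _ xR xRo)
                   dG@(lde dGʳ) dH@(lde dHʳ) G≽H@(noMove⇒noMove , match) w =
    [ from (rightWinsFirst⇔ (H ⊕ X)) ∘ inj₁ ∘ noMove
    , (λ (k , l) → Ro-⊕-elim {G} {X} (λ K → ¬ T (leftWinsFirst K) → T (rightWinsFirst (H ⊕ X)))
        (λ a → let j , gRa≽hRj = match a in
          rightWinsFirst-move (Ro-⊕ˡ H X j) ∘ contraposition (≽-leftWinsFirst X (dGʳ a) (dHʳ j) gRa≽hRj))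
        (λ b → rightWinsFirst-move (Ro-⊕ʳ H X b) ∘ contraposition (≽-leftWinsFirst (xRo b) dG dH G≽H))
        k l)
    ]′ (to (rightWinsFirst⇔ (G ⊕ X)) w)
    where
    noMove : nR + xR ≡ 0 → mR + xR ≡ 0
    noMove z = cong₂ _+_ (noMove⇒noMove (m+n≡0⇒m≡0 nR z)) (m+n≡0⇒n≡0 nR z)

≽⇒≥g : ∀ {G H} → LeftDeadEnd G → LeftDeadEnd H → G ≽ H → G ≥g H
≽⇒≥g {G} {H} dG dH G≽H =
  ≥g-intro {G} {H} λ X → ≽-leftWinsFirst X dG dH G≽H , ≽-rightWinsFirst X dG dH G≽H

all-or-any : ∀ {n} {P Q : Fin n → Set} → (∀ i → P i ⊎ Q i) → (∀ i → P i) ⊎ ∃ Q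
all-or-any {zero} _ = inj₁ (λ ())
all-or-any {suc n} h with h zero | all-or-any (h ∘ suc)
... | inj₂ q | _ = inj₂ (zero , q)
... | inj₁ _ | inj₂ (i , q) = inj₂ (suc i , q)
... | inj₁ p | inj₁ ps = inj₁ λ { zero → p ; (suc i) → ps i }

any-or-all : ∀ {n} {P Q : Fin n → Set} → (∀ i → P i ⊎ Q i) → ∃ P ⊎ (∀ i → Q i)
any-or-all h = Sum.swap (all-or-any (Sum.swap ∘ h))

Distinguishes : Game → Game → Set
Distinguishes G H = ∃ λ X → T (rightWinsFirst (G ⊕ X)) × ¬ T (rightWinsFirst (H ⊕ X))

leftInteger : ℕ → Game
leftInteger zero = zeroG
leftInteger (suc k) = mk 1 (λ _ → leftInteger k) 0 (λ ())

-- Right follows a Right run of D of length m while Left counts the integer down; after m rounds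
-- Right is the one unable to move, and so wins.
mutual
  leftInteger-rightWinsFirst : ∀ {D m} → LeftDeadEnd D → SomeRun D m →
    T (rightWinsFirst (D ⊕ leftInteger m))
  leftInteger-rightWinsFirst {D@(mk 0 _ _ _)} {zero} (lde _) noMove =
    from (rightWinsFirst⇔ (D ⊕ zeroG)) (inj₁ (trans (+-identityʳ _) noMove))
  leftInteger-rightWinsFirst {D} {suc m} dD (k , run) =
    rightWinsFirst-move (Ro-⊕ˡ D _ k) (leftInteger-leftLosesFirst (LeftDeadEnd-Ro dD k) run)

  leftInteger-leftLosesFirst : ∀ {D m} → LeftDeadEnd D → SomeRun D m →
    ¬ T (leftWinsFirst (D ⊕ leftInteger (suc m)))
  leftInteger-leftLosesFirst dD run = leftLosesFirst-⊕ dD zero (λ _ → leftInteger-rightWinsFirst dD run)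

-- In G + X Right moves to Gⁱ + X, where Left must move to Gⁱ + Z and Right answers with
-- Gⁱ + (m+1), m the length of a Right run of Gⁱ, which Left loses.  In H + X Right's only move
-- is to the Left dead end H + 0, where Left cannot move and wins.
distinguish-noRight : ∀ {G H} → LeftDeadEnd G → LeftDeadEnd H → Fin (Rn G) → Rn H ≡ 0 →
  Distinguishes G H
distinguish-noRight {G} {H} dG dH@(lde _) i refl =
  X , rightWinsFirst-move (Ro-⊕ˡ G X i) (leftLosesFirst-⊕ dGⁱ zero (λ _ → rightWins-Gⁱ⊕Z))
    , rightLosesFirst (H ⊕ X) zero
        (Ro-⊕-elim {H} {X} (T ∘ leftWinsFirst) (λ ())
          (λ _ → leftWinsFirst-deadEnd (LeftDeadEnd-⊕ dH (LeftDeadEnd-nbar 0))))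
  where
  dGⁱ = LeftDeadEnd-Ro dG i
  m = proj₁ (someRun (Ro G i))
  Z X : Game
  Z = mk 0 (λ ()) 1 (λ _ → leftInteger (suc m))
  X = mk 1 (λ _ → Z) 1 (λ _ → zeroG)
  rightWins-Gⁱ⊕Z : T (rightWinsFirst (Ro G i ⊕ Z))
  rightWins-Gⁱ⊕Z = rightWinsFirst-move (Ro-⊕ʳ (Ro G i) Z zero)
    (leftInteger-leftLosesFirst dGⁱ (proj₂ (someRun (Ro G i))))

-- Right wins G + X by moving to Gⁱ + X, while Left answers every Right move Hʲ + X of H + X
-- with Hʲ + Xʲ.
distinguish-options : ∀ {G H} → LeftDeadEnd G → LeftDeadEnd H → Fin (Rn H) → (i : Fin (Rn G)) →
  (∀ j → Distinguishes (Ro G i) (Ro H j)) → Distinguishes G H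
distinguish-options {G} {H} dG dH@(lde dHʳ) j₀ i dist =
  X , rightWinsFirst-move (Ro-⊕ˡ G X i)
        (leftLosesFirst-⊕ (LeftDeadEnd-Ro dG i) j₀ (λ j → proj₁ (proj₂ (dist j))))
    , rightLosesFirst (H ⊕ X) (j₀ ↑ˡ 0)
        (Ro-⊕-elim {H} {X} (T ∘ leftWinsFirst)
          (λ j → leftWinsFirst-⊕ (dHʳ j) j (proj₂ (proj₂ (dist j)))) (λ ()))
  where
  X : Game
  X = mk (Rn H) (proj₁ ∘ dist) 0 (λ ())

≽-or-distinguished : ∀ {G H} → LeftDeadEnd G → LeftDeadEnd H → G ≽ H ⊎ Distinguishes G H
≽-or-distinguished (lde {nR = zero} _) (lde {nR = zero} _) = inj₁ ((λ _ → refl) , λ ())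
≽-or-distinguished (lde {nR = zero} _) dH@(lde {nR = suc _} _) =
  inj₂ (zeroG , tt , rightLosesFirst-deadEnd (LeftDeadEnd-⊕ dH (LeftDeadEnd-nbar 0)) zero)
≽-or-distinguished dG@(lde {nR = suc _} _) dH@(lde {nR = zero} _) =
  inj₂ (distinguish-noRight dG dH zero refl)
≽-or-distinguished dG@(lde {nR = suc _} dGʳ) dH@(lde {nR = suc _} dHʳ) =
  Sum.map ((λ ()) ,_) (λ (i , dist) → distinguish-options dG dH zero i dist)
    (all-or-any λ i → any-or-all λ j → ≽-or-distinguished (dGʳ i) (dHʳ j))

≥g⇒≽ : ∀ {G H} → LeftDeadEnd G → LeftDeadEnd H → G ≥g H → G ≽ H
≥g⇒≽ {G} {H} dG dH G≥H =
  [ id , (λ (X , w , l) → ⊥-elim (l (≥g-rightWinsFirst {G} {H} G≥H X w))) ]′ (≽-or-distinguished dG dH)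

≥g-Ro : ∀ {G H} → LeftDeadEnd G → LeftDeadEnd H → G ≥g H → ∀ i → ∃ λ j → Ro G i ≥g Ro H j
≥g-Ro dG@(lde dGʳ) dH@(lde dHʳ) G≥H i =
  Product.map₂ (λ {j} → ≽⇒≥g (dGʳ i) (dHʳ j)) (proj₂ (≥g⇒≽ dG dH G≥H) i)

≽nbar⇔AllRuns : ∀ G n → G ≽ nbar n ⇔ AllRuns G n
≽nbar⇔AllRuns (mk _ _ zero _) zero = mk⇔ (λ _ → refl) (λ _ → (λ _ → refl) , λ ())
≽nbar⇔AllRuns (mk _ _ (suc _) _) zero =
  mk⇔ (λ (_ , match) → ⊥-elim (¬Fin0 (proj₁ (match zero)))) (λ ())
≽nbar⇔AllRuns (mk _ _ zero _) (suc n) =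
  mk⇔ (λ (noMove⇒noMove , _) → ⊥-elim (1+n≢0 (noMove⇒noMove refl))) (⊥-elim ∘ ¬Fin0 ∘ proj₁)
≽nbar⇔AllRuns (mk _ _ (suc _) gR) (suc n) = mk⇔
  (λ (_ , match) → zero , λ k → to (≽nbar⇔AllRuns (gR k) n) (proj₂ (match k)))
  (λ (_ , all) → (λ ()) , λ k → zero , from (≽nbar⇔AllRuns (gR k) n) (all k))

nbar≽⇔SomeRun : ∀ G n → nbar n ≽ G ⇔ SomeRun G n
nbar≽⇔SomeRun (mk _ _ _ _) zero =
  mk⇔ (λ (noMove⇒noMove , _) → noMove⇒noMove refl) (λ noMove → (λ _ → noMove) , λ ())
nbar≽⇔SomeRun (mk _ _ _ gR) (suc n) = mk⇔
  (λ (_ , match) → Product.map₂ (λ {k} → to (nbar≽⇔SomeRun (gR k) n)) (match zero))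
  (λ run → (λ ()) , λ _ → Product.map₂ (λ {k} → from (nbar≽⇔SomeRun (gR k) n)) run)

≥nbar⇔AllRuns : ∀ {G} n → LeftDeadEnd G → G ≥g nbar n ⇔ AllRuns G n
≥nbar⇔AllRuns {G} n dG = mk⇔
  (to (≽nbar⇔AllRuns G n) ∘ ≥g⇒≽ dG (LeftDeadEnd-nbar n))
  (≽⇒≥g dG (LeftDeadEnd-nbar n) ∘ from (≽nbar⇔AllRuns G n))

nbar≥⇔SomeRun : ∀ {G} n → LeftDeadEnd G → nbar n ≥g G ⇔ SomeRun G n
nbar≥⇔SomeRun {G} n dG = mk⇔
  (to (nbar≽⇔SomeRun G n) ∘ ≥g⇒≽ (LeftDeadEnd-nbar n) dG)
  (≽⇒≥g (LeftDeadEnd-nbar n) dG ∘ from (nbar≽⇔SomeRun G n))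

≡g-zero⇔ : ∀ {G} → LeftDeadEnd G → G ≡g zeroG ⇔ Rn G ≡ 0
≡g-zero⇔ dG = mk⇔ (to (nbar≥⇔SomeRun 0 dG) ∘ proj₂)
  (λ noMove → from (≥nbar⇔AllRuns 0 dG) noMove , from (nbar≥⇔SomeRun 0 dG) noMove)

Rigid : ℕ → Game → Set
Rigid n K = SomeRun K n → AllRuns K n

-- Goodness only yields ¬ ¬ (Gʲ ≥ Gⁱ); decidability of AllRuns removes the double negation.
goodOption-rigid : ∀ {G H} n (i : Fin (Rn G)) → LeftDeadEnd G → LeftDeadEnd H →
  (∀ j → ¬ (Ro G i >g Ro G j)) → Ro G i ≥g nbar n → H ≥g G → ∀ k → Rigid n (Ro H k)
goodOption-rigid {G} {H} n i dG dH good Gⁱ≥n H≥G k run =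
  decidable-stable (AllRuns? (Ro H k) n) λ ¬all →
    good j (Gⁱ≥Gʲ , λ (_ , Gʲ≥Gⁱ) → ¬all (to (≥nbar⇔AllRuns n dHᵏ) (Hᵏ≥n Gʲ≥Gⁱ)))
  where
  open ≥g-Reasoning
  dHᵏ = LeftDeadEnd-Ro dH k
  j = proj₁ (≥g-Ro dH dG H≥G k)
  Hᵏ≥Gʲ : Ro H k ≥g Ro G j
  Hᵏ≥Gʲ = proj₂ (≥g-Ro dH dG H≥G k)
  Gⁱ≥Gʲ : Ro G i ≥g Ro G j
  Gⁱ≥Gʲ = begin Ro G j ≲⟨ Hᵏ≥Gʲ ⟩ Ro H k ≲⟨ from (nbar≥⇔SomeRun n dHᵏ) run ⟩ nbar n ≲⟨ Gⁱ≥n ⟩ Ro G i ∎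
  Hᵏ≥n : Ro G j ≥g Ro G i → Ro H k ≥g nbar n
  Hᵏ≥n Gʲ≥Gⁱ = begin nbar n ≲⟨ Gⁱ≥n ⟩ Ro G i ≲⟨ Gʲ≥Gⁱ ⟩ Ro G j ≲⟨ Hᵏ≥Gʲ ⟩ Ro H k ∎

-- If all runs of Xᵃ + Y have length n = p + k, then X + Yᵇ has a run of length (p + 1) + (k - 1)
-- through Xᵃ, so by rigidity all its runs have length n, which forces all runs of X to have
-- length p + 1.
AllRuns-⊕-fromˡ : ∀ X Y n (a : Fin (Rn X)) → Fin (Rn Y) → (∀ b → Rigid n (X ⊕ Ro Y b)) →
  AllRuns (Ro X a ⊕ Y) n → AllRuns (X ⊕ Y) (suc n)
AllRuns-⊕-fromˡ X Y n a b rigid all with AllRuns-⊕⁻ (Ro X a) Y n all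
... | p , k , allXᵃ , allY , p+k≡n =
  subst (AllRuns (X ⊕ Y)) (cong suc p+k≡n) (AllRuns-⊕ X Y (suc p) k allX allY)
  where
  m = proj₁ (someRun (Ro Y b))
  runYᵇ = proj₂ (someRun (Ro Y b))
  runX : SomeRun X (suc p)
  runX = a , AllRuns⇒SomeRun (Ro X a) p allXᵃ
  suc[p+m]≡n : suc (p + m) ≡ n
  suc[p+m]≡n =
    trans (sym (+-suc p m)) (trans (cong (p +_) (AllRuns-SomeRun-≡ Y k (suc m) allY (b , runYᵇ))) p+k≡n)
  runX⊕Yᵇ : SomeRun (X ⊕ Ro Y b) n
  runX⊕Yᵇ = subst (SomeRun (X ⊕ Ro Y b)) suc[p+m]≡n (SomeRun-⊕ X (Ro Y b) (suc p) m runX runYᵇ)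
  allX : AllRuns X (suc p)
  allX with AllRuns-⊕⁻ X (Ro Y b) n (rigid b runX⊕Yᵇ)
  ... | q , _ , allX′ , _ , _ = subst (AllRuns X) (sym (AllRuns-SomeRun-≡ X q (suc p) allX′ runX)) allX′

AllRuns-⊕-suc : ∀ X Y n → Fin (Rn X) → Fin (Rn Y) → (∀ k → Rigid n (Ro (X ⊕ Y) k)) →
  ∀ k → AllRuns (Ro (X ⊕ Y) k) n → AllRuns (X ⊕ Y) (suc n)
AllRuns-⊕-suc X Y n x y rigid = Ro-⊕-elim {X} {Y} (λ K → AllRuns K n → AllRuns (X ⊕ Y) (suc n))
  (λ a → AllRuns-⊕-fromˡ X Y n a y rigidʳ)
  (λ b → AllRuns-⊕-comm Y X (suc n) ∘ AllRuns-⊕-fromˡ Y X n b x rigidˡ ∘ AllRuns-⊕-comm X (Ro Y b) n)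
  where
  rigidʳ : ∀ b → Rigid n (X ⊕ Ro Y b)
  rigidʳ b = ∀Ro {P = Rigid n} rigid (Ro-⊕ʳ X Y b)
  rigidˡ : ∀ a → Rigid n (Y ⊕ Ro X a)
  rigidˡ a =
    AllRuns-⊕-comm (Ro X a) Y n ∘ ∀Ro {P = Rigid n} rigid (Ro-⊕ˡ X Y a) ∘ SomeRun-⊕-comm Y (Ro X a) n

decomposition-≥nbar-suc : ∀ {G X Y} n (i : Fin (Rn G)) → LeftDeadEnd G → (∀ j → ¬ (Ro G i >g Ro G j)) →
  Ro G i ≡g nbar n → LeftDeadEnd X → LeftDeadEnd Y → Fin (Rn X) → Fin (Rn Y) → G ≡g (X ⊕ Y) →
  G ≥g nbar (suc n)
decomposition-≥nbar-suc {G} {X} {Y} n i dG good (Gⁱ≥n , n≥Gⁱ) dX dY x y (G≥X⊕Y , X⊕Y≥G) = begin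
  nbar (suc n) ≲⟨ from (≥nbar⇔AllRuns (suc n) dX⊕Y) (AllRuns-⊕-suc X Y n x y rigid k (rigid k runᵏ)) ⟩
  X ⊕ Y        ≲⟨ G≥X⊕Y ⟩
  G            ∎
  where
  open ≥g-Reasoning
  dX⊕Y = LeftDeadEnd-⊕ dX dY
  rigid = goodOption-rigid n i dG dX⊕Y good Gⁱ≥n X⊕Y≥G
  k = proj₁ (≥g-Ro dG dX⊕Y G≥X⊕Y i)
  runᵏ : SomeRun (Ro (X ⊕ Y) k) n
  runᵏ = to (nbar≥⇔SomeRun n (LeftDeadEnd-Ro dX⊕Y k))
    (begin Ro (X ⊕ Y) k ≲⟨ proj₂ (≥g-Ro dG dX⊕Y G≥X⊕Y i) ⟩ Ro G i ≲⟨ n≥Gⁱ ⟩ nbar n ∎)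

mainTheorem19 : (G : Game) (n : ℕ) → LeftDeadEnd G →
    Σ (Fin (numOpts G)) (λ i → GoodOption G i × (option G i ≡g nbar n)) →
    (G ≡g nbar (suc n)) ⊎ Atom G
mainTheorem19 G@(mk 0 _ _ _) n dG@(lde _) (i , good , Gⁱ≡n) with AllRuns? G (suc n)
... | yes all =
  inj₁ (from (≥nbar⇔AllRuns (suc n) dG) all , from (nbar≥⇔SomeRun (suc n) dG) (i , runⁱ))
  where runⁱ = to (nbar≥⇔SomeRun n (LeftDeadEnd-Ro dG i)) (proj₂ Gⁱ≡n)
... | no ¬all = inj₂ (dG , (λ G≡0 → ¬Fin0 (subst Fin (to (≡g-zero⇔ dG) G≡0) i)) , indecomposable)
  where
  indecomposable : ∀ X Y → LeftDeadEnd X → LeftDeadEnd Y → G ≡g (X ⊕ Y) → X ≡g zeroG ⊎ Y ≡g zeroG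
  indecomposable X Y dX@(lde {nR = zero} _) _ _ = inj₁ (from (≡g-zero⇔ dX) refl)
  indecomposable X Y _ dY@(lde {nR = zero} _) _ = inj₂ (from (≡g-zero⇔ dY) refl)
  indecomposable X Y dX@(lde {nR = suc _} _) dY@(lde {nR = suc _} _) G≡X⊕Y =
    ⊥-elim (¬all (to (≥nbar⇔AllRuns (suc n) dG)
      (decomposition-≥nbar-suc n i dG good Gⁱ≡n dX dY zero zero G≡X⊕Y)))
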